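{- Let $P$ be a (loopless) polymatroid on $E=\{1,\dots,n\}$. For $1\le i\le n$ let $\widetilde E_i=\{1,\dots,\mathrm{rk}_P(i)\}$ (taken as disjoint sets), $\widetilde E=\widetilde E_1\sqcup\cdots\sqcup\widetilde E_n$, and $\pi:\widetilde E\to E$ with $\pi^{ -1}(i)=\widetilde E_i$. Then the matroid $\widetilde P$ on $\widetilde E$ with rank function $\mathrm{rk}_{\widetilde P}(S)=\min\{\mathrm{rk}_P(A)+|S\setminus\pi^{ -1}(A)|: A\subseteq E\}$, with the partition $\widetilde E=\widetilde E_1\sqcup\cdots\sqcup\widetilde E_n$, is a minimal multisymmetric lift of $P$, and it is the unique minimal multisymmetric lift of $P$ (up to isomorphism).
   Context: A polymatroid on a finite set $E$ is a function $\mathrm{rk}:2^E\to\mathbb Z_{\ge0}$ that is submodular, monotone, with $\mathrm{rk}(\emptyset)=0$; all polymatroids (and matroids) are assumed loopless: $\mathrm{rk}(A)>0$ for nonempty $A$. A matroid is a polymatroid with $\mathrm{rk}(A)\le|A|$. A flat is a subset maximal among subsets of its rank. A multisymmetric matroid is a loopless matroid $M$ on $\widetilde E$ with a partition $\widetilde E=\widetilde E_1\sqcup\cdots\sqcup\widetilde E_n$ into nonempty blocks such that the group $\Gamma=\mathfrak S_{\widetilde E_1}\times\cdots\times\mathfrak S_{\widetilde E_n}$ acting on $\widetilde E$ maps flats of $M$ to flats of $M$. Such an $M$ is a multisymmetric lift of the polymatroid $P$ on $\{1,\dots,n\}$ if $\mathrm{rk}_P(A)=\mathrm{rk}_M(\bigcup_{i\in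 A}\widetilde E_i)$ for all $A$; it is a minimal multisymmetric lift if moreover $\mathrm{rk}_M(\widetilde E_i)=|\widetilde E_i|$ for all $i$. Isomorphism of multisymmetric lifts means a bijection of ground sets mapping each block $\widetilde E_i$ to the corresponding block and preserving rank. -}

module Defs where

open import Data.Nat using (ℕ; zero; suc; _+_; _≤_; _<_; _⊓_)
open import Data.Fin using (Fin)
open import Data.Fin.Subset using (Subset; ⊥; ⊤; ⁅_⁆; _⊆_; _∩_; _∪_; ∁; ∣_∣; Nonempty)
open import Data.Bool using (Bool; true; false)
open import Data.Vec using (Vec; []; _∷_; lookup; tabulate)
open import Data.List using (List; concatMap; replicate; length)
open import Data.List.Base using () renaming (lookup to lookupL)
open import Data.Product using (Σ; ∃; _×_)
open import Relation.Binary.PropositionalEquality using (_≡_)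
open import Function.Bundles using (_↔_; Inverse)

record Polymatroid (n : ℕ) : Set where
  field
    rk         : Subset n → ℕ
    rk-empty   : rk ⊥ ≡ 0
    monotone   : ∀ A B → A ⊆ B → rk A ≤ rk B
    submodular : ∀ A B → rk (A ∪ B) + rk (A ∩ B) ≤ rk A + rk B
    loopless   : ∀ A → Nonempty A → 0 < rk A

record IsLooplessMatroid {m : ℕ} (r : Subset m → ℕ) : Set where
  field
    rk-empty   : r ⊥ ≡ 0
    bounded    : ∀ A → r A ≤ ∣ A ∣
    monotone   : ∀ A B → A ⊆ B → r A ≤ r B
    submodular : ∀ A B → r (A ∪ B) + r (A ∩ B) ≤ r A + r B
    loopless   : ∀ A → Nonempty A → 0 < r A

IsFlat : {m : ℕ} → (Subset m → ℕ) → Subset m → Set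
IsFlat r F = ∀ G → F ⊆ G → r G ≡ r F → G ≡ F

image : {m m' : ℕ} → Fin m ↔ Fin m' → Subset m → Subset m'
image e S = tabulate (λ y → lookup S (Inverse.from e y))

preimage : {m n : ℕ} → (Fin m → Fin n) → Subset n → Subset m
preimage π A = tabulate (λ x → lookup A (π x))

block : {m n : ℕ} → (Fin m → Fin n) → Fin n → Subset m
block π i = preimage π ⁅ i ⁆

BlockPerm : {m n : ℕ} → (Fin m → Fin n) → Set
BlockPerm {m} π = Σ (Fin m ↔ Fin m) (λ σ → ∀ x → π (Inverse.to σ x) ≡ π x)

record IsMultisymmetric {m n : ℕ} (π : Fin m → Fin n) (r : Subset m → ℕ) : Set where
  field
    matroid        : IsLooplessMatroid r
    blocks-nonempty : ∀ i → ∃ λ x → π x ≡ i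
    flats-preserved : ∀ (σ : BlockPerm π) F → IsFlat r F →
                      IsFlat r (image (Data.Product.proj₁ σ) F)

IsLift : {m n : ℕ} → Polymatroid n → (Fin m → Fin n) → (Subset m → ℕ) → Set
IsLift {n = n} P π r = ∀ (A : Subset n) → Polymatroid.rk P A ≡ r (preimage π A)

IsMinimalMultisymmetricLift : {m n : ℕ} → Polymatroid n → (Fin m → Fin n) → (Subset m → ℕ) → Set
IsMinimalMultisymmetricLift P π r =
  IsMultisymmetric π r × IsLift P π r × (∀ i → r (block π i) ≡ ∣ block π i ∣)

IsomorphicLifts : {m m' n : ℕ} → (Fin m → Fin n) → (Subset m → ℕ) →
                  (Fin m' → Fin n) → (Subset m' → ℕ) → Set
IsomorphicLifts {m} {m'} π r π' r' =
  Σ (Fin m ↔ Fin m') λ f →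
    (∀ x → π' (Inverse.to f x) ≡ π x) × (∀ S → r' (image f S) ≡ r S)

minSub : (n : ℕ) → (Subset n → ℕ) → ℕ
minSub zero    f = f []
minSub (suc n) f = minSub n (λ A → f (false ∷ A)) ⊓ minSub n (λ A → f (true ∷ A))

module Tilde {n : ℕ} (P : Polymatroid n) where
  open Polymatroid P

  d : Fin n → ℕ
  d i = rk ⁅ i ⁆

  -- Ẽ = Ẽ_1 ⊔ ⋯ ⊔ Ẽ_n with |Ẽ_i| = d i, realised as Fin m; the list of
  -- labels lists i exactly d i times (blocks in order 1,…,n).
  labels : List (Fin n)
  labels = concatMap (λ i → replicate (d i) i) (Data.List.allFin n)

  m : ℕ
  m = length labels

  π : Fin m → Fin n
  π = lookupL labels

  rkTilde : Subset m → ℕ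
  rkTilde S = minSub n (λ A → rk A + ∣ S ∩ ∁ (preimage π A) ∣)

-- Any lift r of P satisfies r S ≤ r (π⁻¹A) + |S ∖ π⁻¹A| = rk_P A + |S ∖ π⁻¹A| for every A.
-- The minimum of these bounds is a matroid rank, since the excess |S ∖ π⁻¹A| is jointly
-- submodular in (S, A); it is a lift once rk_P {i} ≤ |Ẽ_i|, by subadditivity of rk_P; and it is
-- invariant under block-preserving permutations, which therefore map its flats to flats.
-- Conversely let r be a multisymmetric lift, F a flat of r and A = {i : Ẽ_i ⊆ F}. For x ∈ F
-- outside π⁻¹A pick y ∉ F in the block of x: the transposition (x y) maps F to a flat containing
-- F - x but not x, so x is a coloop of F. Hence r F ≥ r (π⁻¹A) + |F ∖ π⁻¹A|, the bound at A, and
-- flat closures give r = rk_P̃. Minimality forces |Ẽ_i| = rk_P {i}, so any bijection matching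
-- the blocks is an isomorphism.
module Submission where

open import Defs
open import Data.Bool using (Bool; true; false; _∧_; _∨_; not)
open import Data.Fin using (Fin; zero; suc)
import Data.Fin.Permutation as Perm
import Data.Fin.Permutation.Components as PC
import Data.Fin.Properties as Fin
open import Data.Fin.Subset
  using (Subset; ⊥; ⁅_⁆; _⊆_; _⊂_; _⊃_; _∩_; _∪_; ∁; ∣_∣; Nonempty; Empty; _∈_; _∉_; _─_; _-_)
open import Data.Fin.Subset.Induction using (⊂-wellFounded; ⊃-wellFounded)
open import Data.Fin.Subset.Properties
open import Data.List using (List; []; _∷_; _++_; length; replicate; concatMap; filterᵇ)
import Data.List as List
open import Data.List.Properties using (filter-++; length-++; tabulate-lookup)
open import Data.Nat using (ℕ; zero; suc; _+_; _*_; _≤_; _<_; z≤n; s≤s)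
open import Data.Nat.Properties
open import Algebra.Properties.CommutativeMonoid.Sum +-0-commutativeMonoid using (sum; sum-permute)
open import Algebra.Properties.CommutativeSemigroup +-commutativeSemigroup using (interchange)
open import Data.Product using (Σ; ∃; _×_; _,_; proj₁; proj₂)
open import Data.Sum using (inj₁; inj₂; [_,_]′)
open import Data.Vec using ([]; _∷_; lookup; tabulate; here; there)
open import Data.Vec.Properties
  using (lookup-zipWith; lookup-map; lookup∘tabulate; tabulate∘lookup; tabulate-cong; []=⇒lookup; lookup⇒[]=)
open import Function using (_∘_; id)
open import Function.Bundles using (_↔_; Inverse)
open import Induction.WellFounded using (Acc; acc)
open import Relation.Binary.PropositionalEquality
open import Relation.Nullary using (¬_; ¬?; Dec; yes; no; does; contradiction; _×-dec_; _→-dec_; T?)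

x∈p─q⇒x∉q : ∀ {m} {x : Fin m} {p q : Subset m} → x ∈ p ─ q → x ∉ q
x∈p─q⇒x∉q {p = _ ∷ _} {q = false ∷ _} here          ()
x∈p─q⇒x∉q {p = _ ∷ _} {q = _     ∷ _} (there x∈p─q) (there x∈q) = x∈p─q⇒x∉q x∈p─q x∈q

x∈p⇒⁅x⁆⊆p : ∀ {m} {x : Fin m} {p} → x ∈ p → ⁅ x ⁆ ⊆ p
x∈p⇒⁅x⁆⊆p {x = x} {p} x∈p y∈⁅x⁆ = subst (_∈ p) (sym (x∈⁅y⁆⇒x≡y x y∈⁅x⁆)) x∈p

∪-lub : ∀ {m} {p q r : Subset m} → p ⊆ r → q ⊆ r → p ∪ q ⊆ r
∪-lub {p = p} {q} p⊆r q⊆r = [ p⊆r , q⊆r ]′ ∘ x∈p∪q⁻ p q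

∩-monoˡ : ∀ {m} {p q : Subset m} (r : Subset m) → p ⊆ q → p ∩ r ⊆ q ∩ r
∩-monoˡ {p = p} r p⊆q x∈p∩r with x∈p∩q⁻ p r x∈p∩r
... | x∈p , x∈r = x∈p∩q⁺ (p⊆q x∈p , x∈r)

p⊆p-x∪⁅x⁆ : ∀ {m} (p : Subset m) x → p ⊆ (p - x) ∪ ⁅ x ⁆
p⊆p-x∪⁅x⁆ p x {y} y∈p with y Fin.≟ x
... | yes refl = x∈p∪q⁺ (inj₂ (x∈⁅x⁆ x))
... | no  y≢x  = x∈p∪q⁺ (inj₁ (x∈p∧x≢y⇒x∈p-y y∈p y≢x))

p⊆q∪p∩∁q : ∀ {m} (p q : Subset m) → p ⊆ q ∪ (p ∩ ∁ q)
p⊆q∪p∩∁q p q {x} x∈p with x ∈? q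
... | yes x∈q = x∈p∪q⁺ (inj₁ x∈q)
... | no  x∉q = x∈p∪q⁺ (inj₂ (x∈p∩q⁺ (x∈p , x∉p⇒x∈∁p x∉q)))

⊈⇒∃ : ∀ {m} {p q : Subset m} → ¬ (p ⊆ q) → ∃ λ x → x ∈ p × x ∉ q
⊈⇒∃ {m} {p} {q} p⊈q
  with Fin.¬∀⟶∃¬ m (λ x → x ∈ p → x ∈ q) (λ x → x ∈? p →-dec x ∈? q) (λ p⊆q → p⊈q (p⊆q _))
... | x , x∈p↛x∈q with x ∈? p | x ∈? q
...   | _       | yes x∈q = contradiction (λ _ → x∈q) x∈p↛x∈q
...   | yes x∈p | no  x∉q = x , x∈p , x∉q
...   | no  x∉p | no  _   = contradiction (λ x∈p → contradiction x∈p x∉p) x∈p↛x∈q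

removal-induction : ∀ {m} (Q : Subset m → Set) →
                    (∀ C → Empty C → Q C) → (∀ C x → x ∈ C → Q (C - x) → Q C) → ∀ C → Q C
removal-induction Q base step C = go C (⊂-wellFounded C)
  where
  go : ∀ C → Acc _⊂_ C → Q C
  go C (acc smaller) with nonempty? C
  ... | no  empty     = base C empty
  ... | yes (x , x∈C) = step C x x∈C (go (C - x) (smaller (x∈p⇒p-x⊂p x∈C)))

∈-tabulate⁺ : ∀ {m} {f : Fin m → Bool} {x} → f x ≡ true → x ∈ tabulate f
∈-tabulate⁺ {f = f} {x} fx = lookup⇒[]= x (tabulate f) (trans (lookup∘tabulate f x) fx)

∈-tabulate⁻ : ∀ {m} {f : Fin m → Bool} {x} → x ∈ tabulate f → f x ≡ true
∈-tabulate⁻ {f = f} {x} x∈ = trans (sym (lookup∘tabulate f x)) ([]=⇒lookup x∈)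

setOf : ∀ {n} {P : Fin n → Set} → (∀ x → Dec (P x)) → Subset n
setOf P? = tabulate (does ∘ P?)

∈-setOf⁺ : ∀ {n} {P : Fin n → Set} (P? : ∀ x → Dec (P x)) {x} → P x → x ∈ setOf P?
∈-setOf⁺ P? {x} px with P? x in eq
... | yes _  = ∈-tabulate⁺ (cong does eq)
... | no ¬px = contradiction px ¬px

∈-setOf⁻ : ∀ {n} {P : Fin n → Set} (P? : ∀ x → Dec (P x)) {x} → x ∈ setOf P? → P x
∈-setOf⁻ P? {x} x∈ with P? x | ∈-tabulate⁻ {f = does ∘ P?} x∈
... | yes px | _ = px
... | no  _  | ()

∈-preimage⁺ : ∀ {m n} {g : Fin m → Fin n} {A x} → g x ∈ A → x ∈ preimage g A
∈-preimage⁺ gx∈A = ∈-tabulate⁺ ([]=⇒lookup gx∈A)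

∈-preimage⁻ : ∀ {m n} {g : Fin m → Fin n} {A x} → x ∈ preimage g A → g x ∈ A
∈-preimage⁻ {A = A} x∈ = lookup⇒[]= _ A (∈-tabulate⁻ x∈)

preimage-mono : ∀ {m n} (g : Fin m → Fin n) {A B} → A ⊆ B → preimage g A ⊆ preimage g B
preimage-mono g A⊆B = ∈-preimage⁺ ∘ A⊆B ∘ ∈-preimage⁻

preimage-∩ : ∀ {m n} (g : Fin m → Fin n) A B → preimage g (A ∩ B) ≡ preimage g A ∩ preimage g B
preimage-∩ {zero}  g A B = refl
preimage-∩ {suc m} g A B = cong₂ _∷_ (lookup-zipWith _∧_ (g zero) A B) (preimage-∩ (g ∘ suc) A B)

preimage-∪ : ∀ {m n} (g : Fin m → Fin n) A B → preimage g (A ∪ B) ≡ preimage g A ∪ preimage g B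
preimage-∪ {zero}  g A B = refl
preimage-∪ {suc m} g A B = cong₂ _∷_ (lookup-zipWith _∨_ (g zero) A B) (preimage-∪ (g ∘ suc) A B)

preimage-∁ : ∀ {m n} (g : Fin m → Fin n) A → preimage g (∁ A) ≡ ∁ (preimage g A)
preimage-∁ {zero}  g A = refl
preimage-∁ {suc m} g A = cong₂ _∷_ (lookup-map (g zero) not A) (preimage-∁ (g ∘ suc) A)

preimage-∘ : ∀ {k m n} (h : Fin m → Fin n) (g : Fin k → Fin m) A →
             preimage (h ∘ g) A ≡ preimage g (preimage h A)
preimage-∘ h g A = tabulate-cong (λ x → sym (lookup∘tabulate (lookup A ∘ h) (g x)))

preimage-cong : ∀ {m n} {g h : Fin m → Fin n} → (∀ x → g x ≡ h x) → ∀ A → preimage g A ≡ preimage h A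
preimage-cong g≗h A = tabulate-cong (cong (lookup A) ∘ g≗h)

preimage-id : ∀ {n} (A : Subset n) → preimage id A ≡ A
preimage-id = tabulate∘lookup

image-flip : ∀ {m m'} (e : Fin m ↔ Fin m') S → image (Perm.flip e) (image e S) ≡ S
image-flip e S = begin
  preimage (Inverse.to e) (preimage (Inverse.from e) S)  ≡⟨ preimage-∘ (Inverse.from e) (Inverse.to e) S ⟨
  preimage (Inverse.from e ∘ Inverse.to e) S            ≡⟨ preimage-cong (λ _ → Perm.inverseˡ e) S ⟩
  preimage id S                                         ≡⟨ preimage-id S ⟩
  S                                                     ∎
  where open ≡-Reasoning

χ : Bool → ℕ
χ true  = 1
χ false = 0

∣∷∣ : ∀ {m} b (p : Subset m) → ∣ b ∷ p ∣ ≡ χ b + ∣ p ∣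
∣∷∣ true  p = refl
∣∷∣ false p = refl

∣tabulate∣ : ∀ {m} (f : Fin m → Bool) → ∣ tabulate f ∣ ≡ sum (χ ∘ f)
∣tabulate∣ {zero}  f = refl
∣tabulate∣ {suc m} f = trans (∣∷∣ (f zero) (tabulate (f ∘ suc))) (cong (χ (f zero) +_) (∣tabulate∣ (f ∘ suc)))

∣image∣ : ∀ {m m'} (e : Fin m ↔ Fin m') (S : Subset m) → ∣ image e S ∣ ≡ ∣ S ∣
∣image∣ e S = begin
  ∣ image e S ∣                        ≡⟨ ∣tabulate∣ (lookup S ∘ Inverse.from e) ⟩
  sum (χ ∘ lookup S ∘ Inverse.from e)  ≡⟨ sum-permute (χ ∘ lookup S) (Perm.flip e) ⟨
  sum (χ ∘ lookup S)                   ≡⟨ ∣tabulate∣ (lookup S) ⟨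
  ∣ tabulate (lookup S) ∣              ≡⟨ cong ∣_∣ (tabulate∘lookup S) ⟩
  ∣ S ∣                                ∎
  where open ≡-Reasoning

∣preimage∘↔∣ : ∀ {k k' n} (e : Fin k ↔ Fin k') (g : Fin k' → Fin n) A →
               ∣ preimage (g ∘ Inverse.to e) A ∣ ≡ ∣ preimage g A ∣
∣preimage∘↔∣ e g A = trans (cong ∣_∣ (preimage-∘ g (Inverse.to e) A)) (∣image∣ (Perm.flip e) (preimage g A))

∣p∪q∣+∣p∩q∣≡∣p∣+∣q∣ : ∀ {m} (p q : Subset m) → ∣ p ∪ q ∣ + ∣ p ∩ q ∣ ≡ ∣ p ∣ + ∣ q ∣
∣p∪q∣+∣p∩q∣≡∣p∣+∣q∣ []          []          = refl
∣p∪q∣+∣p∩q∣≡∣p∣+∣q∣ (true  ∷ p) (true  ∷ q) =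
  cong suc (trans (+-suc _ _) (trans (cong suc (∣p∪q∣+∣p∩q∣≡∣p∣+∣q∣ p q)) (sym (+-suc ∣ p ∣ ∣ q ∣))))
∣p∪q∣+∣p∩q∣≡∣p∣+∣q∣ (true  ∷ p) (false ∷ q) = cong suc (∣p∪q∣+∣p∩q∣≡∣p∣+∣q∣ p q)
∣p∪q∣+∣p∩q∣≡∣p∣+∣q∣ (false ∷ p) (true  ∷ q) =
  trans (cong suc (∣p∪q∣+∣p∩q∣≡∣p∣+∣q∣ p q)) (sym (+-suc ∣ p ∣ ∣ q ∣))
∣p∪q∣+∣p∩q∣≡∣p∣+∣q∣ (false ∷ p) (false ∷ q) = ∣p∪q∣+∣p∩q∣≡∣p∣+∣q∣ p q

∣p∪q∣≤∣p∣+∣q∣ : ∀ {m} (p q : Subset m) → ∣ p ∪ q ∣ ≤ ∣ p ∣ + ∣ q ∣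
∣p∪q∣≤∣p∣+∣q∣ p q = ≤-trans (m≤m+n _ _) (≤-reflexive (∣p∪q∣+∣p∩q∣≡∣p∣+∣q∣ p q))

∣p∣+∣q∣≡∣p∪q∣ : ∀ {m} {p q : Subset m} → Empty (p ∩ q) → ∣ p ∣ + ∣ q ∣ ≡ ∣ p ∪ q ∣
∣p∣+∣q∣≡∣p∪q∣ {m} {p} {q} disjoint = begin
  ∣ p ∣ + ∣ q ∣              ≡⟨ ∣p∪q∣+∣p∩q∣≡∣p∣+∣q∣ p q ⟨
  ∣ p ∪ q ∣ + ∣ p ∩ q ∣      ≡⟨ cong (λ s → ∣ p ∪ q ∣ + ∣ s ∣) (Empty-unique disjoint) ⟩
  ∣ p ∪ q ∣ + ∣ ⊥ {m} ∣      ≡⟨ cong (∣ p ∪ q ∣ +_) (∣⊥∣≡0 m) ⟩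
  ∣ p ∪ q ∣ + 0              ≡⟨ +-identityʳ _ ⟩
  ∣ p ∪ q ∣                  ∎
  where open ≡-Reasoning

∣p∣≤1+∣p-x∣ : ∀ {m} (p : Subset m) x → ∣ p ∣ ≤ 1 + ∣ p - x ∣
∣p∣≤1+∣p-x∣ p x = begin
  ∣ p ∣                  ≤⟨ p⊆q⇒∣p∣≤∣q∣ (p⊆p-x∪⁅x⁆ p x) ⟩
  ∣ (p - x) ∪ ⁅ x ⁆ ∣    ≤⟨ ∣p∪q∣≤∣p∣+∣q∣ (p - x) ⁅ x ⁆ ⟩
  ∣ p - x ∣ + ∣ ⁅ x ⁆ ∣  ≡⟨ cong (∣ p - x ∣ +_) (∣⁅x⁆∣≡1 x) ⟩
  ∣ p - x ∣ + 1          ≡⟨ +-comm _ 1 ⟩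
  1 + ∣ p - x ∣          ∎
  where open ≤-Reasoning

x∈p⇒0<∣p∣ : ∀ {m} {x : Fin m} {p} → x ∈ p → 0 < ∣ p ∣
x∈p⇒0<∣p∣ x∈p = ≤-trans (s≤s z≤n) (x∈p⇒∣p-x∣<∣p∣ x∈p)

0<∣p∣⇒Nonempty : ∀ {m} (p : Subset m) → 0 < ∣ p ∣ → Nonempty p
0<∣p∣⇒Nonempty {m} p 0<∣p∣ with nonempty? p
... | yes nonempty = nonempty
... | no  empty    = contradiction (trans (cong ∣_∣ (Empty-unique empty)) (∣⊥∣≡0 m)) (>⇒≢ 0<∣p∣)

χ-submodular : ∀ s t a b →
  χ ((s ∨ t) ∧ not (a ∨ b)) + χ ((s ∧ t) ∧ not (a ∧ b)) ≤ χ (s ∧ not a) + χ (t ∧ not b)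
χ-submodular true  true  true  true  = z≤n
χ-submodular true  true  true  false = s≤s z≤n
χ-submodular true  true  false true  = s≤s z≤n
χ-submodular true  true  false false = s≤s (s≤s z≤n)
χ-submodular true  false true  _     = z≤n
χ-submodular true  false false true  = z≤n
χ-submodular true  false false false = s≤s z≤n
χ-submodular false true  true  true  = z≤n
χ-submodular false true  false true  = z≤n
χ-submodular false true  true  false = z≤n
χ-submodular false true  false false = s≤s z≤n
χ-submodular false false _     _     = z≤n

∣∖∣-submodular : ∀ {m} (S T A B : Subset m) →
  ∣ (S ∪ T) ∩ ∁ (A ∪ B) ∣ + ∣ (S ∩ T) ∩ ∁ (A ∩ B) ∣ ≤ ∣ S ∩ ∁ A ∣ + ∣ T ∩ ∁ B ∣
∣∖∣-submodular []      []      []      []      = z≤n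
∣∖∣-submodular (s ∷ S) (t ∷ T) (a ∷ A) (b ∷ B) = begin
  ∣ x ∷ X ∣ + ∣ y ∷ Y ∣                ≡⟨ cong₂ _+_ (∣∷∣ x X) (∣∷∣ y Y) ⟩
  (χ x + ∣ X ∣) + (χ y + ∣ Y ∣)        ≡⟨ interchange (χ x) (∣ X ∣) (χ y) (∣ Y ∣) ⟩
  (χ x + χ y) + (∣ X ∣ + ∣ Y ∣)        ≤⟨ +-mono-≤ (χ-submodular s t a b) (∣∖∣-submodular S T A B) ⟩
  (χ u + χ v) + (∣ U ∣ + ∣ V ∣)        ≡⟨ interchange (χ u) (χ v) (∣ U ∣) (∣ V ∣) ⟩
  (χ u + ∣ U ∣) + (χ v + ∣ V ∣)        ≡⟨ cong₂ _+_ (∣∷∣ u U) (∣∷∣ v V) ⟨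
  ∣ u ∷ U ∣ + ∣ v ∷ V ∣                ∎
  where
  open ≤-Reasoning
  x = (s ∨ t) ∧ not (a ∨ b)
  y = (s ∧ t) ∧ not (a ∧ b)
  u = s ∧ not a
  v = t ∧ not b
  X = (S ∪ T) ∩ ∁ (A ∪ B)
  Y = (S ∩ T) ∩ ∁ (A ∩ B)
  U = S ∩ ∁ A
  V = T ∩ ∁ B

transpose-sendsˡ : ∀ {n} (i j : Fin n) → PC.transpose i j i ≡ j
transpose-sendsˡ i j with i Fin.≟ i
... | yes _   = refl
... | no  i≢i = contradiction refl i≢i

transpose-sendsʳ : ∀ {n} (i j : Fin n) → PC.transpose i j j ≡ i
transpose-sendsʳ i j with j Fin.≟ i
... | yes j≡i = j≡i
... | no  _ with j Fin.≟ j
...   | yes _   = refl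
...   | no  j≢j = contradiction refl j≢j

transpose-fixes : ∀ {n} {i j k : Fin n} → k ≢ i → k ≢ j → PC.transpose i j k ≡ k
transpose-fixes {i = i} {j} {k} k≢i k≢j with k Fin.≟ i
... | yes k≡i = contradiction k≡i k≢i
... | no  _ with k Fin.≟ j
...   | yes k≡j = contradiction k≡j k≢j
...   | no  _   = refl

transpose-preserves : ∀ {m n} (π : Fin m → Fin n) {i j} → π i ≡ π j → ∀ k → π (PC.transpose i j k) ≡ π k
transpose-preserves π {i} {j} πi≡πj k with k Fin.≟ i
... | yes refl = sym πi≡πj
... | no  _ with k Fin.≟ j
...   | yes refl = πi≡πj
...   | no  _    = refl

minSub-≤ : ∀ n (f : Subset n → ℕ) A → minSub n f ≤ f A
minSub-≤ zero    f []          = ≤-refl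
minSub-≤ (suc n) f (false ∷ A) = ≤-trans (m⊓n≤m _ _) (minSub-≤ n _ A)
minSub-≤ (suc n) f (true  ∷ A) = ≤-trans (m⊓n≤n _ _) (minSub-≤ n _ A)

minSub-attained : ∀ n (f : Subset n → ℕ) → ∃ λ A → minSub n f ≡ f A
minSub-attained zero    f = [] , refl
minSub-attained (suc n) f
  with minSub-attained n (f ∘ (false ∷_)) | minSub-attained n (f ∘ (true ∷_))
... | A , fA | B , fB with ≤-total (minSub n (f ∘ (false ∷_))) (minSub n (f ∘ (true ∷_)))
...   | inj₁ ≤ = false ∷ A , trans (m≤n⇒m⊓n≡m ≤) fA
...   | inj₂ ≥ = true ∷ B  , trans (m≥n⇒m⊓n≡n ≥) fB

minSub-greatest : ∀ n (f : Subset n → ℕ) {c} → (∀ A → c ≤ f A) → c ≤ minSub n f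
minSub-greatest n f c≤f with minSub-attained n f
... | A , min≡fA = subst (_ ≤_) (sym min≡fA) (c≤f A)

minSub-mono : ∀ n {f g : Subset n → ℕ} → (∀ A → f A ≤ g A) → minSub n f ≤ minSub n g
minSub-mono n {f} {g} f≤g = minSub-greatest n g (λ A → ≤-trans (minSub-≤ n f A) (f≤g A))

minSub-cong : ∀ n {f g : Subset n → ℕ} → (∀ A → f A ≡ g A) → minSub n f ≡ minSub n g
minSub-cong n f≗g = ≤-antisym (minSub-mono n (≤-reflexive ∘ f≗g)) (minSub-mono n (≤-reflexive ∘ sym ∘ f≗g))

-- Rank functions, flats and coloops

subadditive : ∀ {m} {r : Subset m → ℕ} → (∀ A B → r (A ∪ B) + r (A ∩ B) ≤ r A + r B) →
              ∀ A B → r (A ∪ B) ≤ r A + r B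
subadditive submodular A B = ≤-trans (m≤m+n _ _) (submodular A B)

HasFlatClosure : ∀ {m} → (Subset m → ℕ) → Subset m → Set
HasFlatClosure {m} r T = Σ (Subset m) λ F → T ⊆ F × r F ≡ r T × IsFlat r F

flat-closure : ∀ {m} {r : Subset m → ℕ} → (∀ A B → A ⊆ B → r A ≤ r B) → ∀ T → HasFlatClosure r T
flat-closure {m} {r} monotone T = go T (⊃-wellFounded T)
  where
  go : ∀ T → Acc _⊃_ T → HasFlatClosure r T
  go T (acc larger) with Fin.any? (λ x → ¬? (x ∈? T) ×-dec (r (T ∪ ⁅ x ⁆) ≟ r T))
  ... | yes (x , x∉T , same)
    with go (T ∪ ⁅ x ⁆) (larger (p⊆p∪q ⁅ x ⁆ , x , q⊆p∪q T ⁅ x ⁆ (x∈⁅x⁆ x) , x∉T))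
  ...   | F , T∪x⊆F , rF≡ , flat = F , T∪x⊆F ∘ p⊆p∪q ⁅ x ⁆ , trans rF≡ same , flat
  go T _ | no none = T , id , refl , flat
    where
    flat : IsFlat r T
    flat G T⊆G rG≡rT = ⊆-antisym G⊆T T⊆G
      where
      G⊆T : G ⊆ T
      G⊆T {x} x∈G with x ∈? T
      ... | yes x∈T = x∈T
      ... | no  x∉T = contradiction (x , x∉T , same) none
        where
        same : r (T ∪ ⁅ x ⁆) ≡ r T
        same = ≤-antisym (≤-trans (monotone _ G (∪-lub T⊆G (x∈p⇒⁅x⁆⊆p x∈G))) (≤-reflexive rG≡rT))
                         (monotone _ _ (p⊆p∪q ⁅ x ⁆))

module _ {m} {r : Subset m → ℕ} (M : IsLooplessMatroid r) where
  open IsLooplessMatroid M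

  flat-⊇ : ∀ {G F} → IsFlat r G → r F ≤ r (G ∩ F) → F ⊆ G
  flat-⊇ {G} {F} flat rF≤ = subst (F ⊆_) G∪F≡G (q⊆p∪q G F)
    where
    r[G∪F]≤rG : r (G ∪ F) ≤ r G
    r[G∪F]≤rG = +-cancelʳ-≤ (r (G ∩ F)) _ _ (≤-trans (submodular G F) (+-monoʳ-≤ (r G) rF≤))
    G∪F≡G : G ∪ F ≡ G
    G∪F≡G = flat (G ∪ F) (p⊆p∪q F) (≤-antisym r[G∪F]≤rG (monotone _ _ (p⊆p∪q F)))

  coloop-extends : ∀ {F T x} → x ∈ F → r (F - x) < r F → T ⊆ F → x ∉ T → r T < r (T ∪ ⁅ x ⁆)
  coloop-extends {F} {T} {x} x∈F coloop T⊆F x∉T = +-cancelˡ-≤ (r (F - x)) _ _ (begin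
    r (F - x) + suc (r T)              ≡⟨ +-suc _ _ ⟩
    suc (r (F - x)) + r T              ≤⟨ +-monoˡ-≤ (r T) coloop ⟩
    r F + r T                          ≤⟨ +-mono-≤ (monotone _ _ F⊆) (monotone _ _ T⊆) ⟩
    r ((F - x) ∪ U) + r ((F - x) ∩ U)  ≤⟨ submodular (F - x) U ⟩
    r (F - x) + r U                    ∎)
    where
    open ≤-Reasoning
    U = T ∪ ⁅ x ⁆
    F⊆ : F ⊆ (F - x) ∪ U
    F⊆ = ∪-lub (p⊆p∪q U) (q⊆p∪q (F - x) U ∘ q⊆p∪q T ⁅ x ⁆) ∘ p⊆p-x∪⁅x⁆ F x
    T⊆ : T ⊆ (F - x) ∩ U
    T⊆ z∈T = x∈p∩q⁺ (x∈p∧x≢y⇒x∈p-y (T⊆F z∈T) (λ { refl → x∉T z∈T }) , p⊆p∪q ⁅ x ⁆ z∈T)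

  coloops-count : ∀ {F Y} → Y ⊆ F → ∀ X → X ⊆ F → (∀ {x} → x ∈ X → x ∉ Y) →
                  (∀ {x} → x ∈ X → r (F - x) < r F) → r Y + ∣ X ∣ ≤ r (Y ∪ X)
  coloops-count {F} {Y} Y⊆F = removal-induction Q base step
    where
    Q : Subset m → Set
    Q X = X ⊆ F → (∀ {z} → z ∈ X → z ∉ Y) → (∀ {z} → z ∈ X → r (F - z) < r F) →
          r Y + ∣ X ∣ ≤ r (Y ∪ X)
    base : ∀ X → Empty X → Q X
    base X empty _ _ _ = begin
      r Y + ∣ X ∣     ≡⟨ cong (λ S → r Y + ∣ S ∣) (Empty-unique empty) ⟩
      r Y + ∣ ⊥ {m} ∣ ≡⟨ cong (r Y +_) (∣⊥∣≡0 m) ⟩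
      r Y + 0         ≡⟨ +-identityʳ _ ⟩
      r Y             ≤⟨ monotone _ _ (p⊆p∪q X) ⟩
      r (Y ∪ X)       ∎
      where open ≤-Reasoning
    step : ∀ X x → x ∈ X → Q (X - x) → Q X
    step X x x∈X ih X⊆F disjoint coloops = begin
      r Y + ∣ X ∣            ≤⟨ +-monoʳ-≤ (r Y) (∣p∣≤1+∣p-x∣ X x) ⟩
      r Y + suc ∣ X - x ∣    ≡⟨ +-suc _ _ ⟩
      suc (r Y + ∣ X - x ∣)  ≤⟨ s≤s (ih (X⊆F ∘ X-x⊆X) (disjoint ∘ X-x⊆X) (coloops ∘ X-x⊆X)) ⟩
      suc (r T)              ≤⟨ coloop-extends (X⊆F x∈X) (coloops x∈X) (∪-lub Y⊆F (X⊆F ∘ X-x⊆X)) x∉T ⟩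
      r (T ∪ ⁅ x ⁆)          ≤⟨ monotone _ _ T∪x⊆Y∪X ⟩
      r (Y ∪ X)              ∎
      where
      open ≤-Reasoning
      T = Y ∪ (X - x)
      X-x⊆X : X - x ⊆ X
      X-x⊆X = p─q⊆p X ⁅ x ⁆
      x∉T : x ∉ T
      x∉T = [ disjoint x∈X , (λ x∈X-x → x∈p─q⇒x∉q x∈X-x (x∈⁅x⁆ x)) ]′ ∘ x∈p∪q⁻ Y (X - x)
      T∪x⊆Y∪X : T ∪ ⁅ x ⁆ ⊆ Y ∪ X
      T∪x⊆Y∪X = ∪-lub (∪-lub (p⊆p∪q X) (q⊆p∪q Y X ∘ X-x⊆X)) (q⊆p∪q Y X ∘ x∈p⇒⁅x⁆⊆p x∈X)

BlockPerm-inverse : ∀ {m n} {π : Fin m → Fin n} → BlockPerm π → BlockPerm π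
BlockPerm-inverse {π = π} (σ , π∘σ≗π) =
  Perm.flip σ , λ x → trans (sym (π∘σ≗π (Inverse.from σ x))) (cong π (Perm.inverseʳ σ))

invariant⇒flats-preserved : ∀ {m n} {π : Fin m → Fin n} {r : Subset m → ℕ} →
  (∀ (σ : BlockPerm π) S → r (image (proj₁ σ) S) ≡ r S) →
  ∀ (σ : BlockPerm π) F → IsFlat r F → IsFlat r (image (proj₁ σ) F)
invariant⇒flats-preserved invariant σ@(e , _) F flat G σF⊆G rG≡rσF =
  trans (sym (image-flip (Perm.flip e) G)) (cong (image e) σ⁻¹G≡F)
  where
  σ⁻¹G≡F : image (Perm.flip e) G ≡ F
  σ⁻¹G≡F = flat (image (Perm.flip e) G)
    (subst (_⊆ image (Perm.flip e) G) (image-flip e F) (preimage-mono (Inverse.to e) σF⊆G))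
    (trans (invariant (BlockPerm-inverse σ) G) (trans rG≡rσF (invariant σ F)))

-- The lift rank

-- liftRank P (Tilde.π P) unfolds to Tilde.rkTilde P.
liftRank : ∀ {m n} → Polymatroid n → (Fin m → Fin n) → Subset m → ℕ
liftRank {n = n} P π S = minSub n (λ A → Polymatroid.rk P A + ∣ S ∩ ∁ (preimage π A) ∣)

module _ {m n} (P : Polymatroid n) (π : Fin m → Fin n) where
  open Polymatroid P

  private
    cost : Subset m → Subset n → ℕ
    cost S A = rk A + ∣ S ∩ ∁ (preimage π A) ∣

  liftRank-empty : liftRank P π ⊥ ≡ 0
  liftRank-empty = n≤0⇒n≡0 (begin
    liftRank P π ⊥                    ≤⟨ minSub-≤ n (cost ⊥) ⊥ ⟩
    rk ⊥ + ∣ ⊥ ∩ ∁ (preimage π ⊥) ∣   ≡⟨ cong₂ _+_ rk-empty (cong ∣_∣ (∩-zeroˡ (∁ (preimage π ⊥)))) ⟩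
    0 + ∣ ⊥ {m} ∣                     ≡⟨ ∣⊥∣≡0 m ⟩
    0                                 ∎)
    where open ≤-Reasoning

  liftRank-bounded : ∀ S → liftRank P π S ≤ ∣ S ∣
  liftRank-bounded S = begin
    liftRank P π S                    ≤⟨ minSub-≤ n (cost S) ⊥ ⟩
    rk ⊥ + ∣ S ∩ ∁ (preimage π ⊥) ∣   ≡⟨ cong (_+ _) rk-empty ⟩
    ∣ S ∩ ∁ (preimage π ⊥) ∣          ≤⟨ ∣p∩q∣≤∣p∣ S _ ⟩
    ∣ S ∣                             ∎
    where open ≤-Reasoning

  liftRank-monotone : ∀ S T → S ⊆ T → liftRank P π S ≤ liftRank P π T
  liftRank-monotone S T S⊆T =
    minSub-mono n (λ A → +-monoʳ-≤ (rk A) (p⊆q⇒∣p∣≤∣q∣ (∩-monoˡ (∁ (preimage π A)) S⊆T)))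

  liftRank-submodular : ∀ S T →
    liftRank P π (S ∪ T) + liftRank P π (S ∩ T) ≤ liftRank P π S + liftRank P π T
  liftRank-submodular S T with minSub-attained n (cost S) | minSub-attained n (cost T)
  ... | A , min≡costA | B , min≡costB = begin
    liftRank P π (S ∪ T) + liftRank P π (S ∩ T)
      ≤⟨ +-mono-≤ (minSub-≤ n (cost (S ∪ T)) (A ∪ B)) (minSub-≤ n (cost (S ∩ T)) (A ∩ B)) ⟩
    cost (S ∪ T) (A ∪ B) + cost (S ∩ T) (A ∩ B)
      ≡⟨ interchange (rk (A ∪ B)) _ (rk (A ∩ B)) _ ⟩
    (rk (A ∪ B) + rk (A ∩ B)) + (∣ (S ∪ T) ∩ ∁ (preimage π (A ∪ B)) ∣ + ∣ (S ∩ T) ∩ ∁ (preimage π (A ∩ B)) ∣)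
      ≤⟨ +-mono-≤ (submodular A B) excess-submodular ⟩
    (rk A + rk B) + (∣ S ∩ ∁ (preimage π A) ∣ + ∣ T ∩ ∁ (preimage π B) ∣)
      ≡⟨ interchange (rk A) (rk B) _ _ ⟩
    cost S A + cost T B
      ≡⟨ cong₂ _+_ min≡costA min≡costB ⟨
    liftRank P π S + liftRank P π T ∎
    where
    open ≤-Reasoning
    excess-submodular : ∣ (S ∪ T) ∩ ∁ (preimage π (A ∪ B)) ∣ + ∣ (S ∩ T) ∩ ∁ (preimage π (A ∩ B)) ∣
                        ≤ ∣ S ∩ ∁ (preimage π A) ∣ + ∣ T ∩ ∁ (preimage π B) ∣
    excess-submodular rewrite preimage-∪ π A B | preimage-∩ π A B =
      ∣∖∣-submodular S T (preimage π A) (preimage π B)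

  liftRank-loopless : ∀ S → Nonempty S → 0 < liftRank P π S
  liftRank-loopless S (x , x∈S) with minSub-attained n (cost S)
  ... | A , min≡costA = subst (0 <_) (sym min≡costA) (positive (nonempty? A))
    where
    positive : Dec (Nonempty A) → 0 < cost S A
    positive (yes nonempty) = ≤-trans (loopless A nonempty) (m≤m+n _ _)
    positive (no  empty)    = ≤-trans (x∈p⇒0<∣p∣ x∈S∖A) (m≤n+m _ _)
      where
      x∈S∖A : x ∈ S ∩ ∁ (preimage π A)
      x∈S∖A = x∈p∩q⁺ (x∈S , x∉p⇒x∈∁p (λ x∈A → empty (π x , ∈-preimage⁻ x∈A)))

  liftRank-isLooplessMatroid : IsLooplessMatroid (liftRank P π)
  liftRank-isLooplessMatroid = record
    { rk-empty   = liftRank-empty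
    ; bounded    = liftRank-bounded
    ; monotone   = liftRank-monotone
    ; submodular = liftRank-submodular
    ; loopless   = liftRank-loopless
    }

  liftRank-image : ∀ {m'} {π' : Fin m' → Fin n} (e : Fin m ↔ Fin m') →
                   (∀ x → π' (Inverse.to e x) ≡ π x) → ∀ S → liftRank P π' (image e S) ≡ liftRank P π S
  liftRank-image {π' = π'} e π'∘e≗π S = minSub-cong n (λ A → cong (rk A +_) (excess-image A))
    where
    e⁻¹ = Inverse.from e
    π'≗π∘e⁻¹ : ∀ y → π' y ≡ π (e⁻¹ y)
    π'≗π∘e⁻¹ y = trans (cong π' (sym (Perm.inverseʳ e))) (π'∘e≗π (e⁻¹ y))
    excess-image : ∀ A → ∣ image e S ∩ ∁ (preimage π' A) ∣ ≡ ∣ S ∩ ∁ (preimage π A) ∣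
    excess-image A = begin
      ∣ image e S ∩ ∁ (preimage π' A) ∣
        ≡⟨ cong (λ X → ∣ image e S ∩ ∁ X ∣) π'-preimage ⟩
      ∣ preimage e⁻¹ S ∩ ∁ (preimage e⁻¹ (preimage π A)) ∣
        ≡⟨ cong (λ X → ∣ preimage e⁻¹ S ∩ X ∣) (preimage-∁ e⁻¹ (preimage π A)) ⟨
      ∣ preimage e⁻¹ S ∩ preimage e⁻¹ (∁ (preimage π A)) ∣
        ≡⟨ cong ∣_∣ (preimage-∩ e⁻¹ S _) ⟨
      ∣ image e (S ∩ ∁ (preimage π A)) ∣
        ≡⟨ ∣image∣ e (S ∩ ∁ (preimage π A)) ⟩
      ∣ S ∩ ∁ (preimage π A) ∣
        ∎
      where
      open ≡-Reasoning
      π'-preimage : preimage π' A ≡ preimage e⁻¹ (preimage π A)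
      π'-preimage = trans (preimage-cong π'≗π∘e⁻¹ A) (preimage-∘ π e⁻¹ A)

  liftRank-isMultisymmetric : (∀ i → ∃ λ x → π x ≡ i) → IsMultisymmetric π (liftRank P π)
  liftRank-isMultisymmetric surjective = record
    { matroid         = liftRank-isLooplessMatroid
    ; blocks-nonempty = surjective
    ; flats-preserved = invariant⇒flats-preserved (λ σ → liftRank-image (proj₁ σ) (proj₂ σ))
    }

  module _ (block-bound : ∀ i → rk ⁅ i ⁆ ≤ ∣ block π i ∣) where

    rk≤∣preimage∣ : ∀ C → rk C ≤ ∣ preimage π C ∣
    rk≤∣preimage∣ = removal-induction (λ C → rk C ≤ ∣ preimage π C ∣) base step
      where
      base : ∀ C → Empty C → rk C ≤ ∣ preimage π C ∣
      base C empty = ≤-trans (≤-reflexive (trans (cong rk (Empty-unique empty)) rk-empty)) z≤n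
      step : ∀ C i → i ∈ C → rk (C - i) ≤ ∣ preimage π (C - i) ∣ → rk C ≤ ∣ preimage π C ∣
      step C i i∈C ih = begin
        rk C                                    ≤⟨ monotone _ _ (p⊆p-x∪⁅x⁆ C i) ⟩
        rk ((C - i) ∪ ⁅ i ⁆)                    ≤⟨ subadditive {r = rk} submodular (C - i) ⁅ i ⁆ ⟩
        rk (C - i) + rk ⁅ i ⁆                   ≤⟨ +-mono-≤ ih (block-bound i) ⟩
        ∣ preimage π (C - i) ∣ + ∣ block π i ∣  ≡⟨ ∣p∣+∣q∣≡∣p∪q∣ disjoint ⟩
        ∣ preimage π (C - i) ∪ block π i ∣      ≤⟨ p⊆q⇒∣p∣≤∣q∣ ⊆preimage ⟩
        ∣ preimage π C ∣                        ∎
        where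
        open ≤-Reasoning
        disjoint : Empty (preimage π (C - i) ∩ block π i)
        disjoint (x , x∈) with x∈p∩q⁻ (preimage π (C - i)) (block π i) x∈
        ... | x∈C-i , x∈block = x∈p─q⇒x∉q {p = C} (∈-preimage⁻ x∈C-i) (∈-preimage⁻ x∈block)
        ⊆preimage : preimage π (C - i) ∪ block π i ⊆ preimage π C
        ⊆preimage = ∪-lub (preimage-mono π (p─q⊆p C ⁅ i ⁆)) (preimage-mono π (x∈p⇒⁅x⁆⊆p i∈C))

    liftRank-isLift : IsLift P π (liftRank P π)
    liftRank-isLift A = ≤-antisym (minSub-greatest n (cost A') rk≤cost) min≤rk
      where
      A' = preimage π A
      rk≤cost : ∀ B → rk A ≤ cost A' B
      rk≤cost B = begin
        rk A                              ≤⟨ monotone _ _ (p⊆q∪p∩∁q A B) ⟩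
        rk (B ∪ (A ∩ ∁ B))                ≤⟨ subadditive {r = rk} submodular B (A ∩ ∁ B) ⟩
        rk B + rk (A ∩ ∁ B)               ≤⟨ +-monoʳ-≤ (rk B) (rk≤∣preimage∣ (A ∩ ∁ B)) ⟩
        rk B + ∣ preimage π (A ∩ ∁ B) ∣   ≡⟨ cong (λ X → rk B + ∣ X ∣) preimage-∖ ⟩
        rk B + ∣ A' ∩ ∁ (preimage π B) ∣  ∎
        where
        open ≤-Reasoning
        preimage-∖ : preimage π (A ∩ ∁ B) ≡ A' ∩ ∁ (preimage π B)
        preimage-∖ = trans (preimage-∩ π A (∁ B)) (cong (A' ∩_) (preimage-∁ π B))
      min≤rk : liftRank P π A' ≤ rk A
      min≤rk = begin
        liftRank P π A'        ≤⟨ minSub-≤ n (cost A') A ⟩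
        rk A + ∣ A' ∩ ∁ A' ∣   ≡⟨ cong (λ X → rk A + ∣ X ∣) (∩-inverseʳ A') ⟩
        rk A + ∣ ⊥ {m} ∣       ≡⟨ cong (rk A +_) (∣⊥∣≡0 m) ⟩
        rk A + 0               ≡⟨ +-identityʳ (rk A) ⟩
        rk A                   ∎
        where open ≤-Reasoning

-- Uniqueness

module _ {m n} {P : Polymatroid n} {π : Fin m → Fin n} {r : Subset m → ℕ}
         (multisymmetric : IsMultisymmetric π r) (lift : IsLift P π r) where
  open Polymatroid P using (rk)
  open IsMultisymmetric multisymmetric
  module M = IsLooplessMatroid matroid

  r≤liftRank : ∀ T → r T ≤ liftRank P π T
  r≤liftRank T = minSub-greatest n _ r≤cost
    where
    r≤cost : ∀ A → r T ≤ rk A + ∣ T ∩ ∁ (preimage π A) ∣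
    r≤cost A = begin
      r T                      ≤⟨ M.monotone _ _ (p⊆q∪p∩∁q T A') ⟩
      r (A' ∪ (T ∩ ∁ A'))      ≤⟨ subadditive {r = r} M.submodular A' (T ∩ ∁ A') ⟩
      r A' + r (T ∩ ∁ A')      ≤⟨ +-mono-≤ (≤-reflexive (sym (lift A))) (M.bounded (T ∩ ∁ A')) ⟩
      rk A + ∣ T ∩ ∁ A' ∣      ∎
      where
      open ≤-Reasoning
      A' = preimage π A

  -- The transposition (x y) preserves blocks, so it maps F to a flat containing F - x but not x.
  coloop-of-flat : ∀ {F x y} → IsFlat r F → x ∈ F → y ∉ F → π x ≡ π y → r (F - x) < r F
  coloop-of-flat {F} {x} {y} flat x∈F y∉F πx≡πy = ≰⇒> (y∉F ∘ y∈F)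
    where
    σ : BlockPerm π
    σ = Perm.transpose x y , transpose-preserves π πx≡πy
    σF = image (proj₁ σ) F
    F-x⊆σF∩F : F - x ⊆ σF ∩ F
    F-x⊆σF∩F {z} z∈F-x = x∈p∩q⁺ (∈-preimage⁺ (subst (_∈ F) (sym (transpose-fixes z≢y z≢x)) z∈F) , z∈F)
      where
      z∈F = p─q⊆p F ⁅ x ⁆ z∈F-x
      z≢x = x∉⁅y⁆⇒x≢y (x∈p─q⇒x∉q {p = F} z∈F-x)
      z≢y : z ≢ y
      z≢y refl = y∉F z∈F
    y∈F : r F ≤ r (F - x) → y ∈ F
    y∈F rF≤ = subst (_∈ F) (transpose-sendsʳ y x)
      (∈-preimage⁻ (flat-⊇ matroid (flats-preserved σ F flat) (≤-trans rF≤ (M.monotone _ _ F-x⊆σF∩F)) x∈F))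

  liftRank≤r-flat : ∀ {F} → IsFlat r F → liftRank P π F ≤ r F
  liftRank≤r-flat {F} flat = begin
    liftRank P π F           ≤⟨ minSub-≤ n _ A ⟩
    rk A + ∣ F ∩ ∁ A' ∣      ≡⟨ cong (_+ ∣ F ∩ ∁ A' ∣) (lift A) ⟩
    r A' + ∣ F ∩ ∁ A' ∣      ≤⟨ coloops-count matroid A'⊆F (F ∩ ∁ A') (p∩q⊆p F (∁ A')) ∉A' coloop ⟩
    r (A' ∪ (F ∩ ∁ A'))      ≤⟨ M.monotone _ _ (∪-lub A'⊆F (p∩q⊆p F (∁ A'))) ⟩
    r F                      ∎
    where
    open ≤-Reasoning
    block⊆F? : ∀ i → Dec (block π i ⊆ F)
    block⊆F? i = block π i ⊆? F
    A : Subset n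
    A = setOf block⊆F?
    A' : Subset m
    A' = preimage π A
    A'⊆F : A' ⊆ F
    A'⊆F x∈A' = ∈-setOf⁻ block⊆F? (∈-preimage⁻ x∈A') (∈-preimage⁺ {g = π} (x∈⁅x⁆ _))
    ∉A' : ∀ {x} → x ∈ F ∩ ∁ A' → x ∉ A'
    ∉A' x∈ = x∈∁p⇒x∉p (proj₂ (x∈p∩q⁻ F (∁ A') x∈))
    coloop : ∀ {x} → x ∈ F ∩ ∁ A' → r (F - x) < r F
    coloop {x} x∈ with ⊈⇒∃ (λ block⊆F → ∉A' x∈ (∈-preimage⁺ (∈-setOf⁺ block⊆F? block⊆F)))
    ... | y , y∈block , y∉F =
      coloop-of-flat flat (proj₁ (x∈p∩q⁻ F (∁ A') x∈)) y∉F (sym (x∈⁅y⁆⇒x≡y (π x) (∈-preimage⁻ y∈block)))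

  r≡liftRank : ∀ T → r T ≡ liftRank P π T
  r≡liftRank T with flat-closure M.monotone T
  ... | F , T⊆F , rF≡rT , flat = ≤-antisym (r≤liftRank T) (begin
    liftRank P π T   ≤⟨ liftRank-monotone P π T F T⊆F ⟩
    liftRank P π F   ≤⟨ liftRank≤r-flat flat ⟩
    r F              ≡⟨ rF≡rT ⟩
    r T              ∎)
    where open ≤-Reasoning

-- Move a point y of the fibre of π 0 to 0 by a transposition, then match the rest recursively.
fibres-bijection : ∀ {m m' n} (π : Fin m → Fin n) (π' : Fin m' → Fin n) →
                   (∀ i → ∣ block π i ∣ ≡ ∣ block π' i ∣) →
                   Σ (Fin m ↔ Fin m') λ f → ∀ x → π' (Inverse.to f x) ≡ π x
fibres-bijection {zero}  {zero}   π π' _    = Perm.id , λ ()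
fibres-bijection {zero}  {suc _}  π π' same =
  contradiction (same (π' zero)) (<⇒≢ (x∈p⇒0<∣p∣ (∈-preimage⁺ {g = π'} (x∈⁅x⁆ (π' zero)))))
fibres-bijection {suc _} {zero}   π π' same =
  contradiction (same (π zero)) (>⇒≢ (x∈p⇒0<∣p∣ (∈-preimage⁺ {g = π} (x∈⁅x⁆ (π zero)))))
fibres-bijection {suc m} {suc m'} π π' same = Perm.lift₀ g Perm.∘ₚ τ , respects
  where
  i = π zero
  fibre-nonempty : Nonempty (block π' i)
  fibre-nonempty = 0<∣p∣⇒Nonempty (block π' i)
    (subst (0 <_) (same i) (x∈p⇒0<∣p∣ (∈-preimage⁺ {g = π} (x∈⁅x⁆ i))))
  y = proj₁ fibre-nonempty
  τ = Perm.transpose zero y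
  ρ = π' ∘ Inverse.to τ
  ρ0≡i : ρ zero ≡ i
  ρ0≡i = trans (cong π' (transpose-sendsˡ zero y)) (x∈⁅y⁆⇒x≡y i (∈-preimage⁻ {g = π'} (proj₂ fibre-nonempty)))
  same-tail : ∀ j → ∣ block (π ∘ suc) j ∣ ≡ ∣ block (ρ ∘ suc) j ∣
  same-tail j = +-cancelˡ-≡ (χ (lookup ⁅ j ⁆ i)) _ _ (begin
    χ (lookup ⁅ j ⁆ i) + ∣ block (π ∘ suc) j ∣        ≡⟨ ∣∷∣ (lookup ⁅ j ⁆ i) (block (π ∘ suc) j) ⟨
    ∣ block π j ∣                                     ≡⟨ same j ⟩
    ∣ block π' j ∣                                    ≡⟨ ∣preimage∘↔∣ τ π' ⁅ j ⁆ ⟨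
    ∣ block ρ j ∣                                     ≡⟨ ∣∷∣ (lookup ⁅ j ⁆ (ρ zero)) (block (ρ ∘ suc) j) ⟩
    χ (lookup ⁅ j ⁆ (ρ zero)) + ∣ block (ρ ∘ suc) j ∣  ≡⟨ cong (λ k → χ (lookup ⁅ j ⁆ k) + ρ-tail) ρ0≡i ⟩
    χ (lookup ⁅ j ⁆ i) + ∣ block (ρ ∘ suc) j ∣        ∎)
    where
    open ≡-Reasoning
    ρ-tail : ℕ
    ρ-tail = ∣ block (ρ ∘ suc) j ∣
  tail-bijection = fibres-bijection (π ∘ suc) (ρ ∘ suc) same-tail
  g = proj₁ tail-bijection
  respects : ∀ x → ρ (Inverse.to (Perm.lift₀ g) x) ≡ π x
  respects zero    = ρ0≡i
  respects (suc x) = proj₂ tail-bijection x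

-- Block sizes of P̃

∣preimage∣≡length-filter : ∀ {k n} (g : Fin k → Fin n) A →
                          ∣ preimage g A ∣ ≡ length (filterᵇ (lookup A) (List.tabulate g))
∣preimage∣≡length-filter {zero}  g A = refl
∣preimage∣≡length-filter {suc k} g A with lookup A (g zero)
... | true  = cong suc (∣preimage∣≡length-filter (g ∘ suc) A)
... | false = ∣preimage∣≡length-filter (g ∘ suc) A

length-filter-∷ : ∀ {A : Set} (p : A → Bool) x xs →
                  length (filterᵇ p (x ∷ xs)) ≡ χ (p x) + length (filterᵇ p xs)
length-filter-∷ p x xs with p x
... | true  = refl
... | false = refl

length-filter-replicate : ∀ {A : Set} (p : A → Bool) k x → length (filterᵇ p (replicate k x)) ≡ k * χ (p x)
length-filter-replicate p zero    x = refl
length-filter-replicate p (suc k) x with p x in px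
... | true  = cong suc (trans (length-filter-replicate p k x) (cong (λ b → k * χ b) px))
... | false = trans (length-filter-replicate p k x) (cong (λ b → k * χ b) px)

count-concatMap-replicate : ∀ {n} (d : Fin n → ℕ) i (xs : List (Fin n)) →
  length (filterᵇ (lookup ⁅ i ⁆) (concatMap (λ j → replicate (d j) j) xs))
    ≡ d i * length (filterᵇ (lookup ⁅ i ⁆) xs)
count-concatMap-replicate d i []       = sym (*-zeroʳ (d i))
count-concatMap-replicate d i (x ∷ xs) = begin
  length (filterᵇ [i] (replicate (d x) x ++ rest))
    ≡⟨ cong length (filter-++ (T? ∘ [i]) (replicate (d x) x) rest) ⟩
  length (filterᵇ [i] (replicate (d x) x) ++ filterᵇ [i] rest)
    ≡⟨ length-++ (filterᵇ [i] (replicate (d x) x)) ⟩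
  length (filterᵇ [i] (replicate (d x) x)) + length (filterᵇ [i] rest)
    ≡⟨ cong₂ _+_ (length-filter-replicate [i] (d x) x) (count-concatMap-replicate d i xs) ⟩
  d x * χ ([i] x) + d i * length (filterᵇ [i] xs)
    ≡⟨ cong (_+ d i * length (filterᵇ [i] xs)) (only-i-counts ([i] x) refl) ⟩
  d i * χ ([i] x) + d i * length (filterᵇ [i] xs)
    ≡⟨ *-distribˡ-+ (d i) (χ ([i] x)) _ ⟨
  d i * (χ ([i] x) + length (filterᵇ [i] xs))
    ≡⟨ cong (d i *_) (length-filter-∷ [i] x xs) ⟨
  d i * length (filterᵇ [i] (x ∷ xs))
    ∎
  where
  open ≡-Reasoning
  [i] = lookup ⁅ i ⁆
  rest = concatMap (λ j → replicate (d j) j) xs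
  only-i-counts : ∀ b → [i] x ≡ b → d x * χ b ≡ d i * χ b
  only-i-counts true  x∈⁅i⁆ = cong (λ j → d j * 1) (x∈⁅y⁆⇒x≡y i (lookup⇒[]= x ⁅ i ⁆ x∈⁅i⁆))
  only-i-counts false _     = trans (*-zeroʳ (d x)) (sym (*-zeroʳ (d i)))

∣block∣≡d : ∀ {n} (P : Polymatroid n) i → ∣ block (Tilde.π P) i ∣ ≡ Tilde.d P i
∣block∣≡d {n} P i = begin
  ∣ block π i ∣                               ≡⟨ ∣preimage∣≡length-filter π ⁅ i ⁆ ⟩
  length (filterᵇ [i] (List.tabulate π))      ≡⟨ cong (length ∘ filterᵇ [i]) (tabulate-lookup labels) ⟩
  length (filterᵇ [i] labels)                 ≡⟨ count-concatMap-replicate d i (List.allFin n) ⟩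
  d i * length (filterᵇ [i] (List.allFin n))  ≡⟨ cong (d i *_) (∣preimage∣≡length-filter id ⁅ i ⁆) ⟨
  d i * ∣ preimage id ⁅ i ⁆ ∣                 ≡⟨ cong (λ S → d i * ∣ S ∣) (preimage-id ⁅ i ⁆) ⟩
  d i * ∣ ⁅ i ⁆ ∣                             ≡⟨ cong (d i *_) (∣⁅x⁆∣≡1 i) ⟩
  d i * 1                                     ≡⟨ *-identityʳ (d i) ⟩
  d i                                         ∎
  where
  open ≡-Reasoning
  open Tilde P
  [i] = lookup ⁅ i ⁆

theorem2p9 : ∀ (n : ℕ) (P : Polymatroid n) →
    IsMinimalMultisymmetricLift P (Tilde.π P) (Tilde.rkTilde P)
    × (∀ (m' : ℕ) (π' : Fin m' → Fin n) (r' : Subset m' → ℕ) →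
         IsMinimalMultisymmetricLift P π' r' →
         IsomorphicLifts (Tilde.π P) (Tilde.rkTilde P) π' r')
theorem2p9 n P = (liftRank-isMultisymmetric P π surjective , lift , minimal) , unique
  where
  open Polymatroid P using (loopless)
  open Tilde P using (π)
  lift : IsLift P π (liftRank P π)
  lift = liftRank-isLift P π (λ i → ≤-reflexive (sym (∣block∣≡d P i)))
  minimal : ∀ i → liftRank P π (block π i) ≡ ∣ block π i ∣
  minimal i = trans (sym (lift ⁅ i ⁆)) (sym (∣block∣≡d P i))
  surjective : ∀ i → ∃ λ x → π x ≡ i
  surjective i
    with 0<∣p∣⇒Nonempty (block π i) (subst (0 <_) (sym (∣block∣≡d P i)) (loopless ⁅ i ⁆ (i , x∈⁅x⁆ i)))
  ... | x , x∈block = x , x∈⁅y⁆⇒x≡y i (∈-preimage⁻ {g = π} x∈block)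
  unique : ∀ m' (π' : Fin m' → Fin n) r' → IsMinimalMultisymmetricLift P π' r' →
           IsomorphicLifts π (liftRank P π) π' r'
  unique m' π' r' (multisymmetric' , lift' , minimal')
    with fibres-bijection π π' (λ i → trans (∣block∣≡d P i) (trans (lift' ⁅ i ⁆) (minimal' i)))
  ... | f , π'∘f≗π = f , π'∘f≗π , λ S →
    trans (r≡liftRank {P = P} multisymmetric' lift' (image f S)) (liftRank-image P π f π'∘f≗π S)
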